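{- Let $n\ge 2$, let $H_n$ be the binary linear Hamming code of length $2^n-1$, and let $P_n\subseteq H_n$ be a Preparata-like code. Identify the coordinate positions of $\mathbb F_2^{2^n-1}$ with the nonzero vectors of $\mathbb F_2^n$, i.e. with the points of $\mathrm{PG}(n-1,2)$, so that the weight-$3$ codewords of $H_n$ are exactly the characteristic vectors of the lines $\{a,b,a+b\}$ of $\mathrm{PG}(n-1,2)$. Then any partition of $H_n$ into additive translates $P_n+t$ of $P_n$ induces a line-parallelism of $\mathrm{PG}(n-1,2)$: for each translate, the lines whose characteristic vectors are the weight-$3$ codewords in that translate form a line-spread, and these line-spreads (over all translates containing weight-$3$ codewords) partition the set of lines of $\mathrm{PG}(n-1,2)$.
   Context: The binary linear Hamming code $H_n$ of length $2^n-1$ is the binary linear $[2^n-1,2^n-n-1,3]$ code whose parity-check matrix has as columns all distinct nonzero vectors of $\mathbb F_2^n$. A binary code is Preparata-like if it has length $2^n-1$, $2^{2^n-2n}$ codewords, and minimum distance $5$. $\mathrm{PG}(m,2)$ denotes the projective space whose points are the $1$-dimensional subspaces (equivalently nonzero vectors) of $\mathbb F_2^{m+1}$ and whose lines are the $2$-dimensional subspaces (three points $a,b,a+b$). A line-spread is a set of lines partitioning the points; a line-parallelism is a partition of the set of all lines into line-spreads. -}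

module Defs where

open import Data.Bool using (Bool; true; false; _∨_; _xor_; if_then_else_)
open import Data.Bool.Properties using () renaming (_≟_ to _≟B_)
open import Data.Nat using (ℕ; zero; suc; _+_; _*_; _∸_; _^_; _≤_; _≡ᵇ_)
open import Data.Nat.DivMod using (_/_; _%_)
open import Data.Fin using (Fin; toℕ)
open import Data.Vec using (Vec; []; _∷_; replicate; zipWith; tabulate; lookup; foldr)
open import Data.Vec.Properties using (≡-dec)
open import Data.List using (List; length)
open import Data.List.Membership.Propositional using (_∈_)
open import Data.List.Relation.Unary.All using (All)
open import Data.List.Relation.Unary.Unique.Propositional using (Unique)
open import Data.Product using (Σ; ∃; _×_; _,_)
open import Relation.Binary.PropositionalEquality using (_≡_; _≢_)
open import Relation.Nullary.Decidable using (⌊_⌋)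

BVec : ℕ → Set
BVec n = Vec Bool n

_⊕_ : ∀ {n} → BVec n → BVec n → BVec n
_⊕_ = zipWith _xor_

_==_ : ∀ {n} → BVec n → BVec n → Bool
u == v = ⌊ ≡-dec _≟B_ u v ⌋

-- n-bit (little endian) binary representation of k (mod 2^n).
bin : (n : ℕ) → ℕ → BVec n
bin zero    k = []
bin (suc n) k = (k % 2 ≡ᵇ 1) ∷ bin n (k / 2)

len : ℕ → ℕ
len n = 2 ^ n ∸ 1

Word : ℕ → Set
Word n = BVec (len n)

-- Identification of coordinate positions with the nonzero vectors of F_2^n
-- (= points of PG(n-1,2)): position i  ↦  binary representation of i+1.
pt : ∀ n → Fin (len n) → BVec n
pt n i = bin n (suc (toℕ i))

-- Syndrome of a word w.r.t. the parity-check matrix whose columns are pt n i.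
syndrome : ∀ n → Word n → BVec n
syndrome n w = foldr (λ _ → BVec n) _⊕_ (replicate n false)
  (tabulate (λ i → if lookup w i then pt n i else replicate n false))

InHamming : ∀ n → Word n → Set
InHamming n w = syndrome n w ≡ replicate n false

count : ∀ {m} → BVec m → ℕ
count []          = 0
count (true ∷ v)  = suc (count v)
count (false ∷ v) = count v

dist : ∀ {m} → BVec m → BVec m → ℕ
dist u v = count (u ⊕ v)

PreparataLike : ∀ n → List (Word n) → Set
PreparataLike n P =
  Unique P × length P ≡ 2 ^ (2 ^ n ∸ 2 * n) ×
  (∀ x y → x ∈ P → y ∈ P → x ≢ y → 5 ≤ dist x y)

InTranslate : ∀ n → Word n → List (Word n) → Word n → Set
InTranslate n w P t = Σ (Word n) λ p → p ∈ P × w ≡ _⊕_ {len n} p t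

IsTranslatePartition : ∀ n → List (Word n) → (k : ℕ) → (Fin k → Word n) → Set
IsTranslatePartition n P k t =
  (∀ i w → InTranslate n w P (t i) → InHamming n w) ×
  (∀ w → InHamming n w → ∃ λ i → InTranslate n w P (t i)) ×
  (∀ i j w → InTranslate n w P (t i) → InTranslate n w P (t j) → i ≡ j)

lineWord : ∀ n → Fin (len n) → Fin (len n) → Word n
lineWord n a b = tabulate λ j →
  (pt n j == pt n a) ∨ (pt n j == pt n b) ∨ (pt n j == (pt n a ⊕ pt n b))

IsLine : ∀ n → Word n → Set
IsLine n w = Σ (Fin (len n)) λ a → Σ (Fin (len n)) λ b → a ≢ b × w ≡ lineWord n a b

IsLineSpread : ∀ n → (Word n → Set) → Set
IsLineSpread n S =
  ∀ (p : Fin (len n)) →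
    (Σ (Word n) λ w → IsLine n w × S w × lookup w p ≡ true) ×
    (∀ w w' → IsLine n w → IsLine n w' → S w → S w' →
       lookup w p ≡ true → lookup w' p ≡ true → w ≡ w')

-- A translate P + t inherits minimum distance 5 from P. Two distinct lines through a common point have
-- weight 3 and share a coordinate, so they are at distance at most 4: a translate contains at most one line
-- through each point, and the translate of 0 contains none. Counting the cosets of H_n in F₂^(2^n - 1) gives
-- 2^n · k · 2^(2^n - 2n) ≤ 2^(2^n - 1), i.e. k ≤ 2^(n-1). The 2^(n-1) - 1 lines through a point p therefore
-- go injectively into the at most 2^(n-1) - 1 translates other than that of 0, and so each translate containing
-- a line contains one through p.

module Submission where

open import Defs
open import Algebra.Bundles using (AbelianGroup; CommutativeMonoid)
open import Algebra.Structures using (IsAbelianGroup)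
open import Data.Bool using (Bool; true; false; _∨_; _xor_; if_then_else_)
open import Data.Bool.Properties using (xor-assoc; xor-comm; xor-identityˡ; xor-identityʳ; xor-same; ¬-not; ∨-zeroʳ)
  renaming (_≟_ to _≟B_)
open import Data.Empty using (⊥; ⊥-elim)
open import Data.Fin using (Fin; zero; suc; toℕ; fromℕ<; combine; remQuot; punchIn; punchOut)
  renaming (_<_ to _<ᶠ_)
import Data.Fin.Properties as Fin
open import Data.List using (List; length)
open import Data.List.Membership.Propositional.Properties using (∈-lookup)
import Data.List as List
import Data.List.Relation.Unary.All as All
open import Data.List.Relation.Unary.All using (All)
open import Data.List.Relation.Unary.AllPairs using (_∷_)
open import Data.List.Relation.Unary.Unique.Propositional using (Unique)
open import Data.Nat using (ℕ; zero; suc; _+_; _*_; _∸_; _^_; _≤_; z≤n; s≤s; _<_; _≡ᵇ_)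
open import Data.Nat.DivMod using (_/_; _%_; m≡m%n+[m/n]*n; [m+kn]%n≡m%n; m*n%n≡0; m*n/n≡m; +-distrib-/; m%n<n; m<n*o⇒m/o<n)
open import Data.Nat.Properties
open import Data.Nat.Solver using (module +-*-Solver)
open import Data.Product using (Σ; ∃; _×_; _,_; proj₁; proj₂; uncurry)
open import Data.Sum using (_⊎_; inj₁; inj₂)
open import Data.Vec using ([]; _∷_; replicate; tabulate; lookup; foldr)
open import Data.Vec.Properties using (≡-dec; lookup∘tabulate; lookup-zipWith; lookup-replicate; tabulate∘lookup; tabulate-cong;
  zipWith-assoc; zipWith-comm; zipWith-identityˡ; zipWith-identityʳ)
open import Function using (id; _∘_)
open import Level using (0ℓ)
open import Relation.Binary.Definitions using (tri<; tri≈; tri>)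
open import Relation.Binary.PropositionalEquality
  using (_≡_; _≢_; refl; sym; trans; cong; cong₂; subst; isEquivalence; module ≡-Reasoning)
open import Relation.Nullary using (¬_; Dec; yes; no; _×-dec_)
open import Relation.Nullary.Decidable using (from-no)

0v : ∀ m → BVec m
0v m = replicate m false

⊕-self : ∀ {m} (u : BVec m) → u ⊕ u ≡ 0v m
⊕-self []      = refl
⊕-self (x ∷ u) = cong₂ _∷_ (xor-same x) (⊕-self u)

⊕-isAbelianGroup : ∀ m → IsAbelianGroup _≡_ (_⊕_ {m}) (0v m) id
⊕-isAbelianGroup m = record
  { isGroup = record
    { isMonoid = record
      { isSemigroup = record
        { isMagma = record { isEquivalence = isEquivalence ; ∙-cong = cong₂ _⊕_ }
        ; assoc   = zipWith-assoc xor-assoc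
        }
      ; identity = zipWith-identityˡ xor-identityˡ , zipWith-identityʳ xor-identityʳ
      }
    ; inverse = ⊕-self , ⊕-self
    ; ⁻¹-cong = id
    }
  ; comm = zipWith-comm xor-comm
  }

⊕-abelianGroup : ℕ → AbelianGroup 0ℓ 0ℓ
⊕-abelianGroup m = record { isAbelianGroup = ⊕-isAbelianGroup m }

module ⊕ {m : ℕ} where
  open AbelianGroup (⊕-abelianGroup m) public
    using (assoc; comm; identityˡ; identityʳ; commutativeMonoid; commutativeSemigroup)
  open import Algebra.Properties.AbelianGroup (⊕-abelianGroup m) public
    using (xyx⁻¹≈y; inverseˡ-unique; identityʳ-unique; ∙-cancelʳ)
  open import Algebra.Properties.CommutativeSemigroup commutativeSemigroup public
    using (interchange)
  open import Algebra.Properties.CommutativeMonoid.Sum commutativeMonoid public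
    using (sum; ∑-distrib-+; sum-cong-≗; sum-replicate-zero)

module _ {c ℓ} (M : CommutativeMonoid c ℓ) where
  open CommutativeMonoid M using (Carrier; _≈_; _∙_; ε; ∙-congˡ; identityʳ; setoid)
  open import Algebra.Properties.CommutativeMonoid.Sum M using (sum; sum-remove; sum-cong-≋; sum-replicate-zero)
  open import Data.Vec.Functional using (removeAt)
  open import Relation.Binary.Reasoning.Setoid setoid

  sum-single : ∀ {m} (g : Fin m → Carrier) (i : Fin m) → (∀ j → j ≢ i → g j ≈ ε) → sum g ≈ g i
  sum-single {suc m} g i g≈ε = begin
    sum g                     ≈⟨ sum-remove g ⟩
    g i ∙ sum (removeAt g i)  ≈⟨ ∙-congˡ (sum-cong-≋ {m} (λ j → g≈ε (punchIn i j) (Fin.punchInᵢ≢i i j))) ⟩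
    g i ∙ sum {m} (λ _ → ε)   ≈⟨ ∙-congˡ (sum-replicate-zero m) ⟩
    g i ∙ ε                   ≈⟨ identityʳ (g i) ⟩
    g i                       ∎

-- Points of PG(n-1,2) as binary representations

bit : Bool → ℕ
bit false = 0
bit true  = 1

value : ∀ {n} → BVec n → ℕ
value []      = 0
value (b ∷ v) = bit b + value v * 2

bin-suc-bit : ∀ n b k → bin (suc n) (bit b + k * 2) ≡ b ∷ bin n k
bin-suc-bit n false k = cong₂ (λ r q → (r ≡ᵇ 1) ∷ bin n q) (m*n%n≡0 k 2) (m*n/n≡m k 2)
bin-suc-bit n true  k = cong₂ (λ r q → (r ≡ᵇ 1) ∷ bin n q) ([m+kn]%n≡m%n 1 k 2)
  (trans (+-distrib-/ 1 (k * 2) (subst (λ r → 1 + r < 2) (sym (m*n%n≡0 k 2)) ≤-refl)) (m*n/n≡m k 2))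

bin-value : ∀ {n} (s : BVec n) → bin n (value s) ≡ s
bin-value []            = refl
bin-value {suc n} (b ∷ s) = trans (bin-suc-bit n b (value s)) (cong (b ∷_) (bin-value s))

value-injective : ∀ {n} {s s' : BVec n} → value s ≡ value s' → s ≡ s'
value-injective {s = s} {s'} eq = trans (sym (bin-value s)) (trans (cong (bin _) eq) (bin-value s'))

value<2^ : ∀ {n} (s : BVec n) → value s < 2 ^ n
value<2^ []      = s≤s z≤n
value<2^ {suc n} (b ∷ s) = begin-strict
  bit b + value s * 2   <⟨ +-monoˡ-< (value s * 2) (bit<2 b) ⟩
  2 + value s * 2       ≡⟨⟩
  suc (value s) * 2     ≤⟨ *-monoˡ-≤ 2 (value<2^ s) ⟩
  2 ^ n * 2             ≡⟨ *-comm (2 ^ n) 2 ⟩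
  2 ^ suc n             ∎
  where
    open ≤-Reasoning
    bit<2 : ∀ b → bit b < 2
    bit<2 false = s≤s z≤n
    bit<2 true  = s≤s (s≤s z≤n)

value-bin : ∀ n {x} → x < 2 ^ n → value (bin n x) ≡ x
value-bin zero    {zero}  _          = refl
value-bin zero    {suc x} (s≤s ())
value-bin (suc n) {x} x<2^n = begin
  bit (x % 2 ≡ᵇ 1) + value (bin n (x / 2)) * 2
    ≡⟨ cong₂ (λ r q → r + q * 2) (bit-≡ᵇ1 (m%n<n x 2)) (value-bin n (m<n*o⇒m/o<n (subst (x <_) (*-comm 2 (2 ^ n)) x<2^n))) ⟩
  x % 2 + x / 2 * 2
    ≡⟨ sym (m≡m%n+[m/n]*n x 2) ⟩
  x ∎
  where
    open ≡-Reasoning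
    bit-≡ᵇ1 : ∀ {r} → r < 2 → bit (r ≡ᵇ 1) ≡ r
    bit-≡ᵇ1 {0} _ = refl
    bit-≡ᵇ1 {1} _ = refl
    bit-≡ᵇ1 {suc (suc _)} (s≤s (s≤s ()))

value-0v : ∀ n → value (0v n) ≡ 0
value-0v zero    = refl
value-0v (suc n) = cong (_* 2) (value-0v n)

value-pt : ∀ n i → value (pt n i) ≡ suc (toℕ i)
value-pt n i = value-bin n (begin-strict
  suc (toℕ i)   <⟨ s≤s (Fin.toℕ<n i) ⟩
  suc (len n)   ≡⟨ +-comm 1 (len n) ⟩
  len n + 1     ≡⟨ m∸n+n≡m (m^n>0 2 n) ⟩
  2 ^ n         ∎)
  where open ≤-Reasoning

pt-injective : ∀ n {i j} → pt n i ≡ pt n j → i ≡ j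
pt-injective n {i} {j} eq =
  Fin.toℕ-injective (suc-injective (trans (sym (value-pt n i)) (trans (cong value eq) (value-pt n j))))

pt≢0 : ∀ n i → pt n i ≢ 0v n
pt≢0 n i eq = 0≢1+n (trans (sym (value-0v n)) (trans (cong value (sym eq)) (value-pt n i)))

pt-surjective : ∀ n (s : BVec n) → s ≢ 0v n → Σ (Fin (len n)) λ c → pt n c ≡ s
pt-surjective n s s≢0 with value s in eq
... | zero  = ⊥-elim (s≢0 (value-injective (trans eq (sym (value-0v n)))))
... | suc v = fromℕ< v<len , (begin
  bin n (suc (toℕ (fromℕ< v<len)))  ≡⟨ cong (λ x → bin n (suc x)) (Fin.toℕ-fromℕ< v<len) ⟩
  bin n (suc v)                      ≡⟨ cong (bin n) (sym eq) ⟩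
  bin n (value s)                    ≡⟨ bin-value s ⟩
  s                                  ∎)
  where
    open ≡-Reasoning
    v<len : v < len n
    v<len = ∸-monoˡ-≤ 1 (subst (_< 2 ^ n) eq (value<2^ s))

-- Syndromes

select : ∀ n → Bool → BVec n → BVec n
select n b p = if b then p else 0v n

select-xor : ∀ n x y (p : BVec n) → select n (x xor y) p ≡ select n x p ⊕ select n y p
select-xor n true  true  p = sym (⊕-self p)
select-xor n true  false p = sym (⊕.identityʳ p)
select-xor n false y     p = sym (⊕.identityˡ (select n y p))

contribution : ∀ n → Word n → Fin (len n) → BVec n
contribution n w i = select n (lookup w i) (pt n i)

syndrome≡sum : ∀ n (w : Word n) → syndrome n w ≡ ⊕.sum (contribution n w)
syndrome≡sum n w = foldr-tabulate (contribution n w)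
  where
    foldr-tabulate : ∀ {m} (g : Fin m → BVec n) → foldr (λ _ → BVec n) _⊕_ (0v n) (tabulate g) ≡ ⊕.sum g
    foldr-tabulate {zero}  g = refl
    foldr-tabulate {suc m} g = cong (g zero ⊕_) (foldr-tabulate (g ∘ suc))

syndrome-⊕ : ∀ n (u v : Word n) → syndrome n (u ⊕ v) ≡ syndrome n u ⊕ syndrome n v
syndrome-⊕ n u v = begin
  syndrome n (u ⊕ v)
    ≡⟨ syndrome≡sum n (u ⊕ v) ⟩
  ⊕.sum (contribution n (u ⊕ v))
    ≡⟨ ⊕.sum-cong-≗ (λ i → trans (cong (λ b → select n b (pt n i)) (lookup-zipWith _xor_ i u v))
                                  (select-xor n (lookup u i) (lookup v i) (pt n i))) ⟩
  ⊕.sum (λ i → contribution n u i ⊕ contribution n v i)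
    ≡⟨ ⊕.∑-distrib-+ (contribution n u) (contribution n v) ⟩
  ⊕.sum (contribution n u) ⊕ ⊕.sum (contribution n v)
    ≡⟨ sym (cong₂ _⊕_ (syndrome≡sum n u) (syndrome≡sum n v)) ⟩
  syndrome n u ⊕ syndrome n v ∎
  where open ≡-Reasoning

syndrome-0 : ∀ n → syndrome n (0v (len n)) ≡ 0v n
syndrome-0 n = trans (syndrome≡sum n (0v (len n)))
  (trans (⊕.sum-cong-≗ (λ i → cong (λ b → select n b (pt n i)) (lookup-replicate i false)))
         (⊕.sum-replicate-zero (len n)))

≡⇒== : ∀ {m} {u v : BVec m} → u ≡ v → u == v ≡ true
≡⇒== {u = u} {v} u≡v with ≡-dec _≟B_ u v
... | yes _   = refl
... | no u≢v  = ⊥-elim (u≢v u≡v)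

≢⇒== : ∀ {m} {u v : BVec m} → u ≢ v → u == v ≡ false
≢⇒== {u = u} {v} u≢v with ≡-dec _≟B_ u v
... | yes u≡v = ⊥-elim (u≢v u≡v)
... | no _    = refl

==⇒≡ : ∀ {m} {u v : BVec m} → u == v ≡ true → u ≡ v
==⇒≡ {u = u} {v} h with ≡-dec _≟B_ u v
==⇒≡ _  | yes u≡v = u≡v
==⇒≡ () | no _

unit : ∀ n → Fin (len n) → Word n
unit n i = tabulate λ j → pt n j == pt n i

syndrome-unit : ∀ n i → syndrome n (unit n i) ≡ pt n i
syndrome-unit n i = begin
  syndrome n (unit n i)                               ≡⟨ syndrome≡sum n (unit n i) ⟩
  ⊕.sum (contribution n (unit n i))                   ≡⟨ sum-single ⊕.commutativeMonoid _ i off-i ⟩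
  contribution n (unit n i) i                         ≡⟨ cong (λ b → select n b (pt n i)) (trans (lookup∘tabulate _ i) (≡⇒== refl)) ⟩
  pt n i                                              ∎
  where
    open ≡-Reasoning
    off-i : ∀ j → j ≢ i → contribution n (unit n i) j ≡ 0v n
    off-i j j≢i = cong (λ b → select n b (pt n j))
      (trans (lookup∘tabulate _ j) (≢⇒== (λ eq → j≢i (pt-injective n eq))))

syndrome-surjective : ∀ n (s : BVec n) → Σ (Word n) λ w → syndrome n w ≡ s
syndrome-surjective n s with ≡-dec _≟B_ s (0v n)
... | yes s≡0 = 0v (len n) , trans (syndrome-0 n) (sym s≡0)
... | no s≢0  = let (c , pt≡s) = pt-surjective n s s≢0 in unit n c , trans (syndrome-unit n c) pt≡s

count-⊕≤ : ∀ {m} (x y : BVec m) → count (x ⊕ y) ≤ count x + count y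
count-⊕≤ []         []         = z≤n
count-⊕≤ (true ∷ x)  (true ∷ y)  = ≤-trans (count-⊕≤ x y) (+-mono-≤ (n≤1+n _) (n≤1+n _))
count-⊕≤ (true ∷ x)  (false ∷ y) = s≤s (count-⊕≤ x y)
count-⊕≤ (false ∷ x) (true ∷ y)  = ≤-trans (s≤s (count-⊕≤ x y)) (≤-reflexive (sym (+-suc _ _)))
count-⊕≤ (false ∷ x) (false ∷ y) = count-⊕≤ x y

dist+2≤ : ∀ {m} (x y : BVec m) (p : Fin m) → lookup x p ≡ true → lookup y p ≡ true →
          dist x y + 2 ≤ count x + count y
dist+2≤ (true ∷ x)  (true ∷ y)  zero    _  _  = begin
  count (x ⊕ y) + 2       ≤⟨ +-monoˡ-≤ 2 (count-⊕≤ x y) ⟩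
  count x + count y + 2   ≡⟨ +-comm (count x + count y) 2 ⟩
  suc (suc (count x + count y))  ≡⟨ cong suc (sym (+-suc (count x) (count y))) ⟩
  suc (count x) + suc (count y) ∎
  where open ≤-Reasoning
dist+2≤ (true ∷ x)  (true ∷ y)  (suc p) hx hy = ≤-trans (dist+2≤ x y p hx hy) (+-mono-≤ (n≤1+n _) (n≤1+n _))
dist+2≤ (true ∷ x)  (false ∷ y) (suc p) hx hy = s≤s (dist+2≤ x y p hx hy)
dist+2≤ (false ∷ x) (true ∷ y)  (suc p) hx hy = ≤-trans (s≤s (dist+2≤ x y p hx hy)) (≤-reflexive (sym (+-suc _ _)))
dist+2≤ (false ∷ x) (false ∷ y) (suc p) hx hy = dist+2≤ x y p hx hy

dist-⊕ʳ : ∀ {m} (x y t : BVec m) → dist (x ⊕ t) (y ⊕ t) ≡ dist x y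
dist-⊕ʳ x y t = cong count (begin
  (x ⊕ t) ⊕ (y ⊕ t)   ≡⟨ ⊕.interchange x t y t ⟩
  (x ⊕ y) ⊕ (t ⊕ t)   ≡⟨ cong ((x ⊕ y) ⊕_) (⊕-self t) ⟩
  (x ⊕ y) ⊕ 0v _      ≡⟨ ⊕.identityʳ (x ⊕ y) ⟩
  x ⊕ y               ∎)
  where open ≡-Reasoning

count-tabulate-false : ∀ {m} (f : Fin m → Bool) → (∀ j → f j ≡ false) → count (tabulate f) ≡ 0
count-tabulate-false {zero}  f f≡false = refl
count-tabulate-false {suc m} f f≡false rewrite f≡false zero = count-tabulate-false (f ∘ suc) (f≡false ∘ suc)

count-tabulate≤1 : ∀ {m} (f : Fin m → Bool) → (∀ i j → f i ≡ true → f j ≡ true → i ≡ j) → count (tabulate f) ≤ 1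
count-tabulate≤1 {zero}  f f-unique = z≤n
count-tabulate≤1 {suc m} f f-unique with f zero in f0
... | true  = s≤s (≤-reflexive (count-tabulate-false (f ∘ suc) (λ j → ¬-not (Fin.0≢1+n ∘ f-unique zero (suc j) f0))))
... | false = count-tabulate≤1 (f ∘ suc) (λ i j fi fj → Fin.suc-injective (f-unique (suc i) (suc j) fi fj))

count-unit : ∀ n i → count (unit n i) ≤ 1
count-unit n i = count-tabulate≤1 _ (λ j j' hj hj' → pt-injective n (trans (==⇒≡ hj) (sym (==⇒≡ hj'))))

-- Lines of PG(n-1,2)

∨≡xor-of-distinct : ∀ {m} {u v w : BVec m} → u ≢ v → u ≢ w → v ≢ w → ∀ x →
  (x == u) ∨ (x == v) ∨ (x == w) ≡ (x == u) xor ((x == v) xor (x == w))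
∨≡xor-of-distinct {u = u} {v} {w} u≢v u≢w v≢w x
  with ≡-dec _≟B_ x u | ≡-dec _≟B_ x v | ≡-dec _≟B_ x w
... | yes x≡u | yes x≡v | _       = ⊥-elim (u≢v (trans (sym x≡u) x≡v))
... | yes x≡u | no _    | yes x≡w = ⊥-elim (u≢w (trans (sym x≡u) x≡w))
... | yes _   | no _    | no _    = refl
... | no _    | yes x≡v | yes x≡w = ⊥-elim (v≢w (trans (sym x≡v) x≡w))
... | no _    | yes _   | no _    = refl
... | no _    | no _    | _       = refl

third-point : ∀ n {a b} → a ≢ b → Σ (Fin (len n)) λ c → pt n c ≡ pt n a ⊕ pt n b
third-point n a≢b = pt-surjective n _ (λ sum≡0 → a≢b (pt-injective n (⊕.inverseˡ-unique _ _ sum≡0)))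

module _ (n : ℕ) {a b c : Fin (len n)} (a≢b : a ≢ b) (c-third : pt n c ≡ pt n a ⊕ pt n b) where

  lineWord≡unit-sum : lineWord n a b ≡ unit n a ⊕ (unit n b ⊕ unit n c)
  lineWord≡unit-sum = trans (tabulate-cong pointwise) (tabulate∘lookup (unit n a ⊕ (unit n b ⊕ unit n c)))
    where
      pa≢pc : pt n a ≢ pt n c
      pa≢pc eq = pt≢0 n b (⊕.identityʳ-unique _ _ (sym (trans eq c-third)))
      pb≢pc : pt n b ≢ pt n c
      pb≢pc eq = pt≢0 n a (⊕.identityʳ-unique _ _ (sym (trans eq (trans c-third (⊕.comm _ _)))))
      pointwise : ∀ j → (pt n j == pt n a) ∨ (pt n j == pt n b) ∨ (pt n j == (pt n a ⊕ pt n b))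
                      ≡ lookup (unit n a ⊕ (unit n b ⊕ unit n c)) j
      pointwise j = begin
        (pt n j == pt n a) ∨ (pt n j == pt n b) ∨ (pt n j == (pt n a ⊕ pt n b))
          ≡⟨ cong (λ p → (pt n j == pt n a) ∨ (pt n j == pt n b) ∨ (pt n j == p)) (sym c-third) ⟩
        (pt n j == pt n a) ∨ (pt n j == pt n b) ∨ (pt n j == pt n c)
          ≡⟨ ∨≡xor-of-distinct (a≢b ∘ pt-injective n) pa≢pc pb≢pc (pt n j) ⟩
        (pt n j == pt n a) xor ((pt n j == pt n b) xor (pt n j == pt n c))
          ≡⟨ sym (cong₂ _xor_ (lookup∘tabulate _ j)
                    (trans (lookup-zipWith _xor_ j (unit n b) (unit n c)) (cong₂ _xor_ (lookup∘tabulate _ j) (lookup∘tabulate _ j)))) ⟩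
        lookup (unit n a) j xor lookup (unit n b ⊕ unit n c) j
          ≡⟨ sym (lookup-zipWith _xor_ j (unit n a) (unit n b ⊕ unit n c)) ⟩
        lookup (unit n a ⊕ (unit n b ⊕ unit n c)) j ∎
        where open ≡-Reasoning

lineWord-inHamming : ∀ n {a b} → a ≢ b → InHamming n (lineWord n a b)
lineWord-inHamming n {a} {b} a≢b = begin
  syndrome n (lineWord n a b)                           ≡⟨ cong (syndrome n) (lineWord≡unit-sum n a≢b c-third) ⟩
  syndrome n (unit n a ⊕ (unit n b ⊕ unit n c))         ≡⟨ syndrome-⊕ n (unit n a) (unit n b ⊕ unit n c) ⟩
  syndrome n (unit n a) ⊕ syndrome n (unit n b ⊕ unit n c)
    ≡⟨ cong (syndrome n (unit n a) ⊕_) (syndrome-⊕ n (unit n b) (unit n c)) ⟩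
  syndrome n (unit n a) ⊕ (syndrome n (unit n b) ⊕ syndrome n (unit n c))
    ≡⟨ cong₂ _⊕_ (syndrome-unit n a) (cong₂ _⊕_ (syndrome-unit n b) (trans (syndrome-unit n c) c-third)) ⟩
  pa ⊕ (pb ⊕ (pa ⊕ pb))                                 ≡⟨ cong (pa ⊕_) (sym (⊕.assoc pb pa pb)) ⟩
  pa ⊕ ((pb ⊕ pa) ⊕ pb)                                 ≡⟨ cong (pa ⊕_) (⊕.xyx⁻¹≈y pb pa) ⟩
  pa ⊕ pa                                               ≡⟨ ⊕-self pa ⟩
  0v n                                                  ∎
  where
    open ≡-Reasoning
    pa = pt n a
    pb = pt n b
    c = proj₁ (third-point n a≢b)
    c-third = proj₂ (third-point n a≢b)

count-lineWord : ∀ n {a b} → a ≢ b → count (lineWord n a b) ≤ 3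
count-lineWord n {a} {b} a≢b = begin
  count (lineWord n a b)                                ≡⟨ cong count (lineWord≡unit-sum n a≢b c-third) ⟩
  count (unit n a ⊕ (unit n b ⊕ unit n c))              ≤⟨ count-⊕≤ (unit n a) (unit n b ⊕ unit n c) ⟩
  count (unit n a) + count (unit n b ⊕ unit n c)        ≤⟨ +-monoʳ-≤ (count (unit n a)) (count-⊕≤ (unit n b) (unit n c)) ⟩
  count (unit n a) + (count (unit n b) + count (unit n c))
    ≤⟨ +-mono-≤ (count-unit n a) (+-mono-≤ (count-unit n b) (count-unit n c)) ⟩
  3                                                     ∎
  where
    open ≤-Reasoning
    c = proj₁ (third-point n a≢b)
    c-third = proj₂ (third-point n a≢b)

count-line : ∀ n {w} → IsLine n w → count w ≤ 3
count-line n (a , b , a≢b , refl) = count-lineWord n a≢b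

lineWord-∋ˡ : ∀ n a b → lookup (lineWord n a b) a ≡ true
lineWord-∋ˡ n a b = trans (lookup∘tabulate _ a)
  (cong (_∨ ((pt n a == pt n b) ∨ (pt n a == (pt n a ⊕ pt n b)))) (≡⇒== {u = pt n a} refl))

lineWord-∋ʳ : ∀ n a b → lookup (lineWord n a b) b ≡ true
lineWord-∋ʳ n a b = trans (lookup∘tabulate _ b)
  (trans (cong (λ x → (pt n b == pt n a) ∨ x ∨ (pt n b == (pt n a ⊕ pt n b))) (≡⇒== {u = pt n b} refl))
         (∨-zeroʳ (pt n b == pt n a)))

lineWord-points : ∀ n a b j → lookup (lineWord n a b) j ≡ true →
  pt n j ≡ pt n a ⊎ pt n j ≡ pt n b ⊎ pt n j ≡ pt n a ⊕ pt n b
lineWord-points n a b j h = on-line (trans (sym (lookup∘tabulate _ j)) h)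
  where
    on-line : (pt n j == pt n a) ∨ (pt n j == pt n b) ∨ (pt n j == (pt n a ⊕ pt n b)) ≡ true →
      pt n j ≡ pt n a ⊎ pt n j ≡ pt n b ⊎ pt n j ≡ pt n a ⊕ pt n b
    on-line h with ≡-dec _≟B_ (pt n j) (pt n a) | ≡-dec _≟B_ (pt n j) (pt n b) | ≡-dec _≟B_ (pt n j) (pt n a ⊕ pt n b)
    on-line _  | yes j≡a | _       | _       = inj₁ j≡a
    on-line _  | no _    | yes j≡b | _       = inj₂ (inj₁ j≡b)
    on-line _  | no _    | no _    | yes j≡c = inj₂ (inj₂ j≡c)
    on-line () | no _    | no _    | no _

-- Counting by injections

AtMostTwoToOne : ∀ {M K} → (Fin M → Fin K) → Set
AtMostTwoToOne f = ∀ x y z → f x ≡ f y → f x ≡ f z → x ≡ y ⊎ x ≡ z ⊎ y ≡ z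

-- Tag each x by whether an earlier element shares its fibre: at most two per fibre makes (f x, tag) injective.
atMostTwoToOne⇒≤ : ∀ {M K} (f : Fin M → Fin K) → AtMostTwoToOne f → M ≤ K * 2
atMostTwoToOne⇒≤ {M} {K} f two = Fin.injective⇒≤ {f = tagged} (λ {x} {x'} → tagged-injective x x')
  where
    HasEarlierTwin : Fin M → Set
    HasEarlierTwin x = ∃ λ y → y <ᶠ x × f y ≡ f x

    hasEarlierTwin? : ∀ x → Dec (HasEarlierTwin x)
    hasEarlierTwin? x = Fin.any? (λ y → (y Fin.<? x) ×-dec (f y Fin.≟ f x))

    tag : ∀ {x} → Dec (HasEarlierTwin x) → Fin 2
    tag (yes _) = suc zero
    tag (no _)  = zero

    tagged : Fin M → Fin (K * 2)
    tagged x = combine (f x) (tag (hasEarlierTwin? x))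

    no-three : ∀ {x y z} → f x ≡ f y → f x ≡ f z → x <ᶠ y → y <ᶠ z → ⊥
    no-three {x} {y} {z} fx≡fy fx≡fz x<y y<z with two x y z fx≡fy fx≡fz
    ... | inj₁ x≡y        = Fin.<⇒≢ x<y x≡y
    ... | inj₂ (inj₁ x≡z) = Fin.<⇒≢ (Fin.<-trans x<y y<z) x≡z
    ... | inj₂ (inj₂ y≡z) = Fin.<⇒≢ y<z y≡z

    tagged-injective : ∀ x x' → tagged x ≡ tagged x' → x ≡ x'
    tagged-injective x x' eq with Fin.combine-injective (f x) _ (f x') _ eq
    ... | fx≡fx' , _ with hasEarlierTwin? x | hasEarlierTwin? x' | Fin.<-cmp x x'
    ... | _        | _         | tri≈ _ x≡x' _ = x≡x'
    ... | no _     | no ¬twin′ | tri< x<x' _ _ = ⊥-elim (¬twin′ (x , x<x' , fx≡fx'))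
    ... | no ¬twin | no _      | tri> _ _ x'<x = ⊥-elim (¬twin (x' , x'<x , sym fx≡fx'))
    ... | yes (y , y<x , fy≡fx) | yes _ | tri< x<x' _ _ =
      ⊥-elim (no-three fy≡fx (trans fy≡fx fx≡fx') y<x x<x')
    ... | yes _ | yes (y , y<x' , fy≡fx') | tri> _ _ x'<x =
      ⊥-elim (no-three fy≡fx' (trans fy≡fx' (sym fx≡fx')) y<x' x'<x)
    tagged-injective x x' eq | _ , () | yes _ | no _  | _
    tagged-injective x x' eq | _ , () | no _  | yes _ | _

atMostTwoToOne-missing⇒ : ∀ {M K} (f : Fin M → Fin K) → AtMostTwoToOne f →
  (j : Fin K) → (∀ x → f x ≢ j) → M + 2 ≤ K * 2
atMostTwoToOne-missing⇒ {M} {suc K} f two j misses = begin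
  M + 2      ≤⟨ +-monoˡ-≤ 2 (atMostTwoToOne⇒≤ f′ two′) ⟩
  K * 2 + 2  ≡⟨ +-comm (K * 2) 2 ⟩
  suc K * 2  ∎
  where
    open ≤-Reasoning
    j≢f : ∀ x → j ≢ f x
    j≢f x = misses x ∘ sym
    f′ : Fin M → Fin K
    f′ x = punchOut (j≢f x)
    two′ : AtMostTwoToOne f′
    two′ x y z e₁ e₂ = two x y z (Fin.punchOut-injective (j≢f x) (j≢f y) e₁) (Fin.punchOut-injective (j≢f x) (j≢f z) e₂)

remQuot-injective : ∀ {a} b {u v : Fin (a * b)} → remQuot {a} b u ≡ remQuot b v → u ≡ v
remQuot-injective {a} b {u} {v} eq =
  trans (sym (Fin.combine-remQuot {a} b u)) (trans (cong (uncurry combine) eq) (Fin.combine-remQuot {a} b v))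

injective₂⇒≤ : ∀ {a b c} (f : Fin a → Fin b → Fin c) →
  (∀ {x y x' y'} → f x y ≡ f x' y' → x ≡ x' × y ≡ y') → a * b ≤ c
injective₂⇒≤ {a} {b} f inj = Fin.injective⇒≤ {f = uncurry f ∘ remQuot b} λ eq →
  let (x≡x' , y≡y') = inj eq in remQuot-injective b (cong₂ _,_ x≡x' y≡y')

injective₃⇒≤ : ∀ {a b c d} (f : Fin a → Fin b → Fin c → Fin d) →
  (∀ {x y z x' y' z'} → f x y z ≡ f x' y' z' → x ≡ x' × y ≡ y' × z ≡ z') → a * (b * c) ≤ d
injective₃⇒≤ {c = c} f inj = injective₂⇒≤ (λ x → uncurry (f x) ∘ remQuot c) λ eq →
  let (x≡x' , y≡y' , z≡z') = inj eq in x≡x' , remQuot-injective c (cong₂ _,_ y≡y' z≡z')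

encode : ∀ {m} → BVec m → Fin (2 ^ m)
encode s = fromℕ< (value<2^ s)

encode-injective : ∀ {m} {s s' : BVec m} → encode s ≡ encode s' → s ≡ s'
encode-injective {s = s} {s'} eq = value-injective
  (trans (sym (Fin.toℕ-fromℕ< (value<2^ s))) (trans (cong toℕ eq) (Fin.toℕ-fromℕ< (value<2^ s'))))

bin-injective : ∀ n {a a' : Fin (2 ^ n)} → bin n (toℕ a) ≡ bin n (toℕ a') → a ≡ a'
bin-injective n {a} {a'} eq = Fin.toℕ-injective
  (trans (sym (value-bin n (Fin.toℕ<n a))) (trans (cong value eq) (value-bin n (Fin.toℕ<n a'))))

n<2^n : ∀ n → n < 2 ^ n
n<2^n zero    = s≤s z≤n
n<2^n (suc n) = ≤-trans (+-mono-≤ (m^n>0 2 n) (n<2^n n)) (≤-reflexive (cong (2 ^ n +_) (sym (+-identityʳ (2 ^ n)))))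

2*n≤2^n : ∀ n → 2 * n ≤ 2 ^ n
2*n≤2^n zero    = z≤n
2*n≤2^n (suc n) = *-monoʳ-≤ 2 (n<2^n n)

coset-bound⇒k*2≤2^n : ∀ n k → 2 ^ n * (k * 2 ^ (2 ^ n ∸ 2 * n)) ≤ 2 ^ (2 ^ n ∸ 1) → k * 2 ≤ 2 ^ n
coset-bound⇒k*2≤2^n n k bound = *-cancelʳ-≤ (k * 2) A (A * B) {{m*n≢0 A B {{m^n≢0 2 n}} {{m^n≢0 2 D}}}} (begin
  k * 2 * (A * B)       ≡⟨ solve 3 (λ a b k → k :* con 2 :* (a :* b) := a :* (k :* b) :* con 2) refl A B k ⟩
  A * (k * B) * 2       ≤⟨ *-monoˡ-≤ 2 bound ⟩
  2 ^ (A ∸ 1) * 2       ≡⟨ *-comm (2 ^ (A ∸ 1)) 2 ⟩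
  2 ^ suc (A ∸ 1)       ≡⟨ cong (2 ^_) (trans (+-comm 1 (A ∸ 1)) (m∸n+n≡m (m^n>0 2 n))) ⟩
  2 ^ A                 ≡⟨ cong (2 ^_) (sym (m+[n∸m]≡n (2*n≤2^n n))) ⟩
  2 ^ (2 * n + D)       ≡⟨ ^-distribˡ-+-* 2 (2 * n) D ⟩
  2 ^ (2 * n) * B       ≡⟨ cong (_* B) (trans (cong (2 ^_) (cong (n +_) (+-identityʳ n))) (^-distribˡ-+-* 2 n n)) ⟩
  A * A * B             ≡⟨ *-assoc A A B ⟩
  A * (A * B)           ∎)
  where
    open ≤-Reasoning
    open +-*-Solver using (solve; _:*_; _:=_; con)
    A = 2 ^ n
    D = A ∸ 2 * n
    B = 2 ^ D

len+2≰2^n : ∀ n → ¬ len n + 2 ≤ 2 ^ n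
len+2≰2^n n le = 1+n≰n (begin
  suc (2 ^ n)        ≡⟨ cong suc (sym (m∸n+n≡m (m^n>0 2 n))) ⟩
  suc (len n + 1)    ≡⟨ sym (+-suc (len n) 1) ⟩
  len n + 2          ≤⟨ le ⟩
  2 ^ n              ∎)
  where open ≤-Reasoning

-- Translates of a Preparata-like code

Unique⇒lookup-injective : ∀ {A : Set} {xs : List A} → Unique xs → ∀ i j → List.lookup xs i ≡ List.lookup xs j → i ≡ j
Unique⇒lookup-injective (_ ∷ _)      zero    zero    _  = refl
Unique⇒lookup-injective (x∉ ∷ _)     zero    (suc j) eq = ⊥-elim (All.lookup x∉ (∈-lookup j) eq)
Unique⇒lookup-injective (x∉ ∷ _)     (suc i) zero    eq = ⊥-elim (All.lookup x∉ (∈-lookup i) (sym eq))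
Unique⇒lookup-injective (_ ∷ unique) (suc i) (suc j) eq = cong suc (Unique⇒lookup-injective unique i j eq)

module Parallelism {n} (P : List (Word n)) (prep : PreparataLike n P) {k} (t : Fin k → Word n)
                   (part : IsTranslatePartition n P k t) where

  Translate : Fin k → Word n → Set
  Translate i w = InTranslate n w P (t i)

  translate-inHamming : ∀ i w → Translate i w → InHamming n w
  translate-inHamming = proj₁ part

  translate-cover : ∀ w → InHamming n w → ∃ λ i → Translate i w
  translate-cover = proj₁ (proj₂ part)

  translate-disjoint : ∀ i j w → Translate i w → Translate j w → i ≡ j
  translate-disjoint = proj₂ (proj₂ part)

  translate-dist : ∀ {i w w'} → Translate i w → Translate i w' → w ≢ w' → 5 ≤ dist w w'
  translate-dist {i} (x , x∈P , refl) (y , y∈P , refl) w≢w' =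
    subst (5 ≤_) (sym (dist-⊕ʳ x y (t i))) (proj₂ (proj₂ prep) x y x∈P y∈P (w≢w' ∘ cong (_⊕ t i)))

  -- Two distinct lines through a common point are at distance at most 3 + 3 - 2 = 4.
  lines-meeting-equal : ∀ {i w w' p} → IsLine n w → IsLine n w' → Translate i w → Translate i w' →
    lookup w p ≡ true → lookup w' p ≡ true → w ≡ w'
  lines-meeting-equal {w = w} {w'} {p} line line' w∈i w'∈i p∈w p∈w' with ≡-dec _≟B_ w w'
  ... | yes w≡w' = w≡w'
  ... | no w≢w'  = ⊥-elim (from-no (7 ≤? 6) (begin
    7                     ≤⟨ +-monoˡ-≤ 2 (translate-dist w∈i w'∈i w≢w') ⟩
    dist w w' + 2         ≤⟨ dist+2≤ w w' p p∈w p∈w' ⟩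
    count w + count w'    ≤⟨ +-mono-≤ (count-line n line) (count-line n line') ⟩
    6                     ∎))
    where open ≤-Reasoning

  zero-translate : Fin k
  zero-translate = proj₁ (translate-cover (0v (len n)) (syndrome-0 n))

  0∈zero-translate : Translate zero-translate (0v (len n))
  0∈zero-translate = proj₂ (translate-cover (0v (len n)) (syndrome-0 n))

  no-line-in-zero-translate : ∀ {w} → IsLine n w → ¬ Translate zero-translate w
  no-line-in-zero-translate {w} line@(a , b , _ , refl) w∈0 = from-no (5 ≤? 3) (begin
    5                       ≤⟨ translate-dist w∈0 0∈zero-translate w≢0 ⟩
    dist w (0v (len n))     ≡⟨ cong count (⊕.identityʳ w) ⟩
    count w                 ≤⟨ count-line n line ⟩
    3                       ∎)
    where
      open ≤-Reasoning
      w≢0 : w ≢ 0v (len n)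
      w≢0 w≡0 with trans (sym (lineWord-∋ˡ n a b)) (trans (cong (λ v → lookup v a) w≡0) (lookup-replicate a false))
      ... | ()

  k*2≤2^n : k * 2 ≤ 2 ^ n
  k*2≤2^n = coset-bound⇒k*2≤2^n n k (subst (λ L → 2 ^ n * (k * L) ≤ 2 ^ len n) (proj₁ (proj₂ prep)) cosets)
    where
      codeword : Fin (length P) → Word n
      codeword = List.lookup P

      coset-rep : Fin (2 ^ n) → Word n
      coset-rep a = proj₁ (syndrome-surjective n (bin n (toℕ a)))

      coset : Fin (2 ^ n) → Fin k → Fin (length P) → Word n
      coset a i q = (codeword q ⊕ t i) ⊕ coset-rep a

      in-translate : ∀ i q → Translate i (codeword q ⊕ t i)
      in-translate i q = codeword q , ∈-lookup q , refl

      syndrome-coset : ∀ a i q → syndrome n (coset a i q) ≡ bin n (toℕ a)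
      syndrome-coset a i q = begin
        syndrome n (coset a i q)                                   ≡⟨ syndrome-⊕ n (codeword q ⊕ t i) (coset-rep a) ⟩
        syndrome n (codeword q ⊕ t i) ⊕ syndrome n (coset-rep a)   ≡⟨ cong₂ _⊕_ (translate-inHamming i _ (in-translate i q))
                                                                               (proj₂ (syndrome-surjective n (bin n (toℕ a)))) ⟩
        0v n ⊕ bin n (toℕ a)                                       ≡⟨ ⊕.identityˡ (bin n (toℕ a)) ⟩
        bin n (toℕ a)                                              ∎
        where open ≡-Reasoning

      coset-injective : ∀ {a i q a' i' q'} → coset a i q ≡ coset a' i' q' → a ≡ a' × i ≡ i' × q ≡ q'
      coset-injective {a} {i} {q} {a'} {i'} {q'} eq
        with bin-injective n (trans (sym (syndrome-coset a i q)) (trans (cong (syndrome n) eq) (syndrome-coset a' i' q')))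
      ... | refl with ⊕.∙-cancelʳ (coset-rep a) _ _ eq
      ... | same-codeword with translate-disjoint i i' _ (in-translate i q)
                                 (subst (Translate i') (sym same-codeword) (in-translate i' q'))
      ... | refl = refl , refl , Unique⇒lookup-injective (proj₁ prep) q q' (⊕.∙-cancelʳ (t i) _ _ same-codeword)

      cosets : 2 ^ n * (k * length P) ≤ 2 ^ len n
      cosets = injective₃⇒≤ (λ a i q → encode (coset a i q)) (coset-injective ∘ encode-injective)

  module Pencil (p : Fin (len n)) where

    through : Fin (len n) → Fin k
    through b with p Fin.≟ b
    ... | yes _   = zero-translate
    ... | no p≢b  = proj₁ (translate-cover (lineWord n p b) (lineWord-inHamming n p≢b))

    through-p : through p ≡ zero-translate
    through-p with p Fin.≟ p
    ... | yes _   = refl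
    ... | no p≢p  = ⊥-elim (p≢p refl)

    through-line : ∀ b → p ≢ b → Translate (through b) (lineWord n p b)
    through-line b p≢b with p Fin.≟ b
    ... | yes p≡b  = ⊥-elim (p≢b p≡b)
    ... | no p≢b′  = proj₂ (translate-cover (lineWord n p b) (lineWord-inHamming n p≢b′))

    through-line-nonzero : ∀ b → p ≢ b → through b ≢ zero-translate
    through-line-nonzero b p≢b b↦0 =
      no-line-in-zero-translate (p , b , p≢b , refl) (subst (λ i → Translate i (lineWord n p b)) b↦0 (through-line b p≢b))

    same-translate : ∀ {i x y} → p ≢ x → p ≢ y → Translate i (lineWord n p x) → Translate i (lineWord n p y) →
      x ≡ y ⊎ pt n y ≡ pt n p ⊕ pt n x
    same-translate {x = x} {y} p≢x p≢y x∈i y∈i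
      with lineWord-points n p x y (subst (λ w → lookup w y ≡ true)
             (sym (lines-meeting-equal (p , x , p≢x , refl) (p , y , p≢y , refl) x∈i y∈i (lineWord-∋ˡ n p x) (lineWord-∋ˡ n p y)))
             (lineWord-∋ʳ n p y))
    ... | inj₁ y≡p        = ⊥-elim (p≢y (pt-injective n (sym y≡p)))
    ... | inj₂ (inj₁ y≡x) = inj₁ (pt-injective n (sym y≡x))
    ... | inj₂ (inj₂ y≡c) = inj₂ y≡c

    -- Each translate other than the zero one meets the pencil of lines through p in at most one line {p, b, p+b}.
    through-atMostTwoToOne : AtMostTwoToOne through
    through-atMostTwoToOne x y z x~y x~z = cases (p Fin.≟ x) (p Fin.≟ y) (p Fin.≟ z)
      where
        at-p : ∀ {b} → p ≡ b → through b ≡ zero-translate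
        at-p refl = through-p
        cases : Dec (p ≡ x) → Dec (p ≡ y) → Dec (p ≡ z) → x ≡ y ⊎ x ≡ z ⊎ y ≡ z
        cases (yes p≡x) (yes p≡y) _         = inj₁ (trans (sym p≡x) p≡y)
        cases (yes p≡x) (no p≢y)  _         = ⊥-elim (through-line-nonzero y p≢y (trans (sym x~y) (at-p p≡x)))
        cases (no p≢x)  (yes p≡y) _         = ⊥-elim (through-line-nonzero x p≢x (trans x~y (at-p p≡y)))
        cases (no p≢x)  (no _)    (yes p≡z) = ⊥-elim (through-line-nonzero x p≢x (trans x~z (at-p p≡z)))
        cases (no p≢x)  (no p≢y)  (no p≢z)
          with same-translate p≢x p≢y (through-line x p≢x) (subst (λ i → Translate i _) (sym x~y) (through-line y p≢y))
             | same-translate p≢x p≢z (through-line x p≢x) (subst (λ i → Translate i _) (sym x~z) (through-line z p≢z))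
        ... | inj₁ x≡y       | _               = inj₁ x≡y
        ... | inj₂ _         | inj₁ x≡z        = inj₂ (inj₁ x≡z)
        ... | inj₂ y-on-line | inj₂ z-on-line  = inj₂ (inj₂ (pt-injective n (trans y-on-line (sym z-on-line))))

  -- If the pencil through p missed translate j, its 2^n - 1 points would fill the other k - 1 ≤ 2^(n-1) - 1
  -- translates at most two at a time.
  translate-spread-covers : ∀ j → (Σ (Word n) λ w → IsLine n w × Translate j w) →
    ∀ p → Σ (Word n) λ w → IsLine n w × Translate j w × lookup w p ≡ true
  translate-spread-covers j (w₀ , line₀ , w₀∈j) p with Fin.any? (λ b → Pencil.through p b Fin.≟ j)
  ... | yes (b , b↦j) =
    lineWord n p b , (p , b , p≢b , refl) , subst (λ i → Translate i (lineWord n p b)) b↦j (Pencil.through-line p b p≢b) ,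
    lineWord-∋ˡ n p b
    where
      p≢b : p ≢ b
      p≢b refl = no-line-in-zero-translate line₀ (subst (λ i → Translate i w₀) (trans (sym b↦j) (Pencil.through-p p)) w₀∈j)
  ... | no misses = ⊥-elim (len+2≰2^n n (≤-trans
    (atMostTwoToOne-missing⇒ (Pencil.through p) (Pencil.through-atMostTwoToOne p) j (λ b b↦j → misses (b , b↦j)))
    k*2≤2^n))

  translate-spread : ∀ i → (Σ (Word n) λ w → IsLine n w × Translate i w) → IsLineSpread n (Translate i)
  translate-spread i has-line p =
    translate-spread-covers i has-line p , λ w w' line line' w∈i w'∈i → lines-meeting-equal line line' w∈i w'∈i

  line-in-unique-translate : ∀ w → IsLine n w →
    (∃ λ i → Translate i w) × (∀ i j → Translate i w → Translate j w → i ≡ j)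
  line-in-unique-translate w (a , b , a≢b , refl) = translate-cover w (lineWord-inHamming n a≢b) , λ i j → translate-disjoint i j w

corollary1 : (n : ℕ) → 2 ≤ n →
    (P : List (Word n)) → All (InHamming n) P → PreparataLike n P →
    (k : ℕ) (t : Fin k → Word n) → IsTranslatePartition n P k t →
    (∀ i → (Σ (Word n) λ w → IsLine n w × InTranslate n w P (t i)) →
    IsLineSpread n (λ w → InTranslate n w P (t i))) ×
    (∀ w → IsLine n w →
    (∃ λ i → InTranslate n w P (t i)) × (∀ i j → InTranslate n w P (t i) → InTranslate n w P (t j) → i ≡ j))
corollary1 n _ P _ prep k t part = translate-spread , line-in-unique-translate
  where open Parallelism P prep t part
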